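{- Let $k$ be an integer and let $G$ be a non-complete double-critical $k$-chromatic graph. For any vertex $x\in V(G)$, $$\deg_G(x)-\alpha_x\ \ge\ |B(xy)|+1\ \ge\ k-1,$$ where $y\in N(x)$ is any vertex contained in an independent set in $N[x]$ of size $\alpha_x$. Moreover, $\alpha_x\ge 2$.
   Context: All graphs are finite and simple. A graph $G$ is (vertex-)critical if $\chi(G-v)<\chi(G)$ for every vertex $v$. A critical graph $G$ is double-critical if $\chi(G-x-y)\le \chi(G)-2$ for every edge $xy\in E(G)$ (here $G-x-y$ denotes deletion of both end-vertices). $N(v)$ is the open and $N[v]=N(v)\cup\{v\}$ the closed neighbourhood of $v$. $G_x=G[N(x)]$ is the neighbourhood graph of $x$ and $\alpha_x$ is its independence number. For an edge $xy$, $B(xy)=N(x)\cap N(y)$. -}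

module Defs where

open import Data.Bool using (Bool; true; false)
open import Data.Nat using (ℕ; _≤_; _<_; _∸_)
open import Data.Fin using (Fin)
open import Data.Fin.Subset using (Subset; _∈_; _⊆_; ⊤; _-_; _∪_; ⁅_⁆; ∣_∣)
open import Data.Vec using (tabulate)
open import Data.Product using (Σ; ∃; _×_)
open import Relation.Binary.PropositionalEquality using (_≡_; _≢_)
open import Relation.Nullary using (¬_)

record Graph (n : ℕ) : Set where
  field
    adj   : Fin n → Fin n → Bool
    sym   : ∀ u v → adj u v ≡ adj v u
    irref : ∀ v → adj v v ≡ false

open Graph public

module _ {n : ℕ} (G : Graph n) where

  Edge : Fin n → Fin n → Set
  Edge u v = adj G u v ≡ true

  N : Fin n → Subset n
  N v = tabulate (λ u → adj G v u)

  N[_] : Fin n → Subset n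
  N[ v ] = N v ∪ ⁅ v ⁆

  deg : Fin n → ℕ
  deg v = ∣ N v ∣

  B : Fin n → Fin n → Subset n
  B x y = Data.Fin.Subset._∩_ (N x) (N y)

  Colourable : Subset n → ℕ → Set
  Colourable S c = Σ (Fin n → Fin c) λ f →
    ∀ u v → u ∈ S → v ∈ S → Edge u v → f u ≢ f v

  ChromaticNumber : Subset n → ℕ → Set
  ChromaticNumber S k = Colourable S k × (∀ c → c < k → ¬ Colourable S c)

  Chromatic : ℕ → Set
  Chromatic k = ChromaticNumber ⊤ k

  Independent : Subset n → Set
  Independent I = ∀ u v → u ∈ I → v ∈ I → ¬ Edge u v

  IndependenceNumber : Subset n → ℕ → Set
  IndependenceNumber T a =
    (Σ (Subset n) λ I → I ⊆ T × Independent I × ∣ I ∣ ≡ a)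
    × (∀ I → I ⊆ T → Independent I → ∣ I ∣ ≤ a)

  Critical : Set
  Critical = ∀ k → Chromatic k →
    ∀ v → ∃ λ j → ChromaticNumber (⊤ - v) j × j < k

  DoubleCritical : Set
  DoubleCritical = Critical × (∀ k → Chromatic k →
    ∀ x y → Edge x y → ∃ λ j → ChromaticNumber (⊤ - x - y) j × j ≤ k ∸ 2)

  NonComplete : Set
  NonComplete = ∃ λ u → ∃ λ v → u ≢ v × ¬ Edge u v

module Submission where

-- The whole argument rests on one recolouring lemma: if φ is a j-colouring
-- of G - x - y and G itself is not (j+1)-colourable, then every colour of φ
-- occurs on a common neighbour of x and y (otherwise x takes the missing
-- colour and y joins a fresh colour class).  For an edge xy of a
-- double-critical graph, G - x - y is (k-2)-colourable, so B(xy) contains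
-- k-2 distinct vertices, one per colour; this gives |B(xy)| + 1 ≥ k - 1.
-- The same family together with x and y is a k-clique when N(x) is a clique,
-- and in a critical k-chromatic graph a k-clique contains every vertex; so
-- α_x ≤ 1 would make G complete (x has a neighbour y, since critical graphs
-- have no isolated vertices), whence α_x ≥ 2.  Finally, for a second
-- vertex z of the independent set I ∋ y, the recolouring lemma applied to the
-- edge xz yields w ∈ N(x) ∩ N(z) outside N(y); then B(xy), {w} and I are
-- disjoint subsets of N(x), which gives deg(x) ≥ |B(xy)| + 1 + α_x.

open import Defs hiding (sym)
open import Data.Nat using (ℕ; zero; suc; _≤_; _<_; _∸_; _+_; z≤n; s≤s)
import Data.Nat.Properties as ℕ
open import Data.Fin using (Fin; zero; suc; fromℕ; inject₁; _≟_)
import Data.Fin.Properties as Fin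
open import Data.Fin.Subset using (Subset; _∈_; _⊆_; ∣_∣; _∪_; ⁅_⁆; _-_; ⊤; inside; outside)
open import Data.Fin.Subset.Properties
  using (∈⊤; x∈⁅x⁆; x∈⁅y⁆⇒x≡y; ∣⁅x⁆∣≡1; p⊆q⇒∣p∣≤∣q∣; x∈p∩q⁻; x∈p∩q⁺; x∈p∪q⁻;
         x∈p∧x≢y⇒x∈p-y; x∈p⇒∣p-x∣<∣p∣; p─x─y≡p─y─x; _∈?_)
open import Data.Vec using (_∷_; [])
open import Data.Vec.Properties using (lookup∘tabulate; []=⇒lookup; lookup⇒[]=)
open import Data.Vec.Base using (here; there)
open import Data.Product using (Σ; _×_; _,_; proj₁; proj₂)
open import Data.Sum using (_⊎_; inj₁; inj₂)
open import Data.Empty using (⊥; ⊥-elim)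
open import Relation.Nullary using (¬_; Dec; yes; no)
open import Relation.Nullary.Decidable using (_×-dec_; _⊎-dec_; ¬?)
open import Relation.Binary.PropositionalEquality
  using (_≡_; _≢_; refl; sym; trans; cong; cong₂; subst)
import Data.Bool as Bool
open import Function using (_∘_)

∣p∪q∣≡∣p∣+∣q∣ : ∀ {n} (p q : Subset n) → (∀ {v} → v ∈ p → v ∈ q → ⊥) →
                ∣ p ∪ q ∣ ≡ ∣ p ∣ + ∣ q ∣
∣p∪q∣≡∣p∣+∣q∣ [] [] _ = refl
∣p∪q∣≡∣p∣+∣q∣ (inside ∷ p) (inside ∷ q) disj = ⊥-elim (disj here here)
∣p∪q∣≡∣p∣+∣q∣ (inside ∷ p) (outside ∷ q) disj =
  cong suc (∣p∪q∣≡∣p∣+∣q∣ p q (λ a b → disj (there a) (there b)))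
∣p∪q∣≡∣p∣+∣q∣ (outside ∷ p) (inside ∷ q) disj =
  trans (cong suc (∣p∪q∣≡∣p∣+∣q∣ p q (λ a b → disj (there a) (there b))))
        (sym (ℕ.+-suc ∣ p ∣ ∣ q ∣))
∣p∪q∣≡∣p∣+∣q∣ (outside ∷ p) (outside ∷ q) disj =
  ∣p∪q∣≡∣p∣+∣q∣ p q (λ a b → disj (there a) (there b))

injection⇒≤∣S∣ : ∀ {n} m (f : Fin m → Fin n) → (∀ {i j} → f i ≡ f j → i ≡ j) →
                 (S : Subset n) → (∀ i → f i ∈ S) → m ≤ ∣ S ∣
injection⇒≤∣S∣ zero f inj S f∈S = z≤n
injection⇒≤∣S∣ (suc m) f inj S f∈S =
  ℕ.≤-trans (s≤s (injection⇒≤∣S∣ m (f ∘ suc) (Fin.suc-injective ∘ inj) (S - f zero) rest∈))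
            (x∈p⇒∣p-x∣<∣p∣ (f∈S zero))
  where
  rest∈ : ∀ i → f (suc i) ∈ S - f zero
  rest∈ i = x∈p∧x≢y⇒x∈p-y (f∈S (suc i)) (λ eq → Fin.0≢1+n (sym (inj eq)))

another-element : ∀ {n} (I : Subset n) (y : Fin n) → 2 ≤ ∣ I ∣ →
                  Σ (Fin n) λ z → z ∈ I × z ≢ y
another-element I y 2≤∣I∣ with Fin.any? (λ v → (v ∈? I) ×-dec ¬? (v ≟ y))
... | yes found = found
... | no none = ⊥-elim (ℕ.<⇒≱ 2≤∣I∣ ∣I∣≤1)
  where
  I⊆⁅y⁆ : I ⊆ ⁅ y ⁆
  I⊆⁅y⁆ {v} v∈I with v ≟ y
  ... | yes refl = x∈⁅x⁆ v
  ... | no v≢y = ⊥-elim (none (v , v∈I , v≢y))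
  ∣I∣≤1 : ∣ I ∣ ≤ 1
  ∣I∣≤1 = ℕ.≤-trans (p⊆q⇒∣p∣≤∣q∣ I⊆⁅y⁆) (ℕ.≤-reflexive (∣⁅x⁆∣≡1 y))

module Colourings {n : ℕ} (G : Graph n) where

  E : Fin n → Fin n → Set
  E = Edge G

  E? : ∀ u v → Dec (E u v)
  E? u v = adj G u v Bool.≟ Bool.true

  E-sym : ∀ {u v} → E u v → E v u
  E-sym {u} {v} e = trans (Graph.sym G v u) e

  E-irr : ∀ {u} → ¬ E u u
  E-irr {u} e with trans (sym (irref G u)) e
  ... | ()

  E⇒≢ : ∀ {u v} → E u v → u ≢ v
  E⇒≢ e refl = E-irr e

  ∈N⇒E : ∀ {v u} → u ∈ N G v → E v u
  ∈N⇒E {v} {u} u∈N = trans (sym (lookup∘tabulate (adj G v) u)) ([]=⇒lookup u∈N)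

  E⇒∈N : ∀ {v u} → E v u → u ∈ N G v
  E⇒∈N {v} {u} e = lookup⇒[]= u (N G v) (trans (lookup∘tabulate (adj G v) u) e)

  ∈⊤-a-b : ∀ {a b v : Fin n} → v ≢ a → v ≢ b → v ∈ ⊤ - a - b
  ∈⊤-a-b v≢a v≢b = x∈p∧x≢y⇒x∈p-y (x∈p∧x≢y⇒x∈p-y ∈⊤ v≢a) v≢b

  fresh-colour-class : ∀ {m} (S : Subset n) (P : Fin n → Set) → (∀ v → Dec (P v)) →
    (c : Fin n → Fin m) →
    (∀ u v → u ∈ S → v ∈ S → P u → P v → ¬ E u v) →
    (∀ u v → u ∈ S → v ∈ S → ¬ P u → ¬ P v → E u v → c u ≢ c v) →
    Colourable G S (suc m)
  fresh-colour-class {m} S P P? c P-independent c-proper = colour , proper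
    where
    fresh-if : ∀ {v} → Dec (P v) → Fin m → Fin (suc m)
    fresh-if (yes _) _ = fromℕ m
    fresh-if (no _) i = inject₁ i
    colour : Fin n → Fin (suc m)
    colour v = fresh-if (P? v) (c v)
    proper : ∀ u v → u ∈ S → v ∈ S → E u v → colour u ≢ colour v
    proper u v u∈S v∈S e with P? u | P? v
    ... | yes pu | yes pv = λ _ → P-independent u v u∈S v∈S pu pv e
    ... | yes _  | no _   = Fin.fromℕ≢inject₁
    ... | no _   | yes _  = Fin.fromℕ≢inject₁ ∘ sym
    ... | no pu  | no pv  = c-proper u v u∈S v∈S pu pv e ∘ Fin.inject₁-injective

  add-vertex : ∀ {m} (S : Subset n) (x : Fin n) → Colourable G (S - x) m →
               Colourable G S (suc m)
  add-vertex S x (c , c-proper) = fresh-colour-class S (_≡ x) (_≟ x) c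
    (λ { u v _ _ refl refl e → E-irr e })
    (λ u v u∈S v∈S u≢x v≢x → c-proper u v (x∈p∧x≢y⇒x∈p-y u∈S u≢x) (x∈p∧x≢y⇒x∈p-y v∈S v≢x))

  add-two-vertices : ∀ {j} (x y : Fin n) → Colourable G (⊤ - x - y) j →
                     Colourable G ⊤ (suc (suc j))
  add-two-vertices {j} x y φ =
    add-vertex ⊤ y (add-vertex (⊤ - y) x (subst (λ S → Colourable G S j) (p─x─y≡p─y─x ⊤ x y) φ))

  edge⇒2≤colours : ∀ {m x y} → Colourable G ⊤ m → E x y → 2 ≤ m
  edge⇒2≤colours {zero} {x} (c , _) e with c x
  ... | ()
  edge⇒2≤colours {suc zero} {x} {y} (c , proper) e with c x | c y | proper x y ∈⊤ ∈⊤ e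
  ... | zero | zero | different = ⊥-elim (different refl)
  edge⇒2≤colours {suc (suc m)} _ _ = s≤s (s≤s z≤n)

  -- Otherwise colour x with i and give y, together with the neighbours of x
  -- of colour i, a fresh colour.
  every-colour-on-B : ∀ {j} (x y : Fin n) (φ : Colourable G (⊤ - x - y) j) →
    ¬ Colourable G ⊤ (suc j) →
    (i : Fin j) → Σ (Fin n) λ b → E x b × E y b × proj₁ φ b ≡ i
  every-colour-on-B {j} x y (φ , φ-proper) not-colourable i
    with Fin.any? (λ b → E? x b ×-dec E? y b ×-dec (φ b ≟ i))
  ... | yes found = found
  ... | no none = ⊥-elim (not-colourable recoloured)
    where
    P : Fin n → Set
    P v = v ≡ y ⊎ (v ≢ y × E x v × φ v ≡ i)
    P? : ∀ v → Dec (P v)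
    P? v = (v ≟ y) ⊎-dec (¬? (v ≟ y) ×-dec E? x v ×-dec (φ v ≟ i))
    φ-on-N : ∀ {u v} → u ≢ y → v ≢ y → E x u → E x v → E u v → φ u ≢ φ v
    φ-on-N u≢y v≢y xu xv =
      φ-proper _ _ (∈⊤-a-b (E⇒≢ xu ∘ sym) u≢y) (∈⊤-a-b (E⇒≢ xv ∘ sym) v≢y)
    P-independent : ∀ u v → u ∈ ⊤ → v ∈ ⊤ → P u → P v → ¬ E u v
    P-independent u v _ _ (inj₁ refl) (inj₁ refl) e = E-irr e
    P-independent u v _ _ (inj₁ refl) (inj₂ (_ , xv , φv)) e = none (v , xv , e , φv)
    P-independent u v _ _ (inj₂ (_ , xu , φu)) (inj₁ refl) e = none (u , xu , E-sym e , φu)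
    P-independent u v _ _ (inj₂ (u≢y , xu , φu)) (inj₂ (v≢y , xv , φv)) e =
      φ-on-N u≢y v≢y xu xv e (trans φu (sym φv))
    c : Fin n → Fin j
    c v with v ≟ x
    ... | yes _ = i
    ... | no _ = φ v
    c-proper : ∀ u v → u ∈ ⊤ → v ∈ ⊤ → ¬ P u → ¬ P v → E u v → c u ≢ c v
    c-proper u v _ _ ¬Pu ¬Pv e eq with u ≟ x | v ≟ x
    ... | yes refl | yes refl = E-irr e
    ... | yes refl | no _     = ¬Pv (inj₂ (¬Pv ∘ inj₁ , e , sym eq))
    ... | no _     | yes refl = ¬Pu (inj₂ (¬Pu ∘ inj₁ , E-sym e , eq))
    ... | no u≢x   | no v≢x   =
      φ-proper u v (∈⊤-a-b u≢x (¬Pu ∘ inj₁)) (∈⊤-a-b v≢x (¬Pv ∘ inj₁)) e eq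
    recoloured : Colourable G ⊤ (suc j)
    recoloured = fresh-colour-class ⊤ P P? c P-independent c-proper

  -- Consequence: if ψ is a j-colouring of G - x - z, G is not (j+1)-colourable
  -- and y ∈ N(x) is distinct from z, then some w ∈ N(x) ∩ N(z) is not adjacent
  -- to y, namely a common neighbour of x and z carrying the colour of y.
  common-neighbour-avoiding : ∀ {j x y z} (ψ : Colourable G (⊤ - x - z) j) →
    ¬ Colourable G ⊤ (suc j) → E x y → y ≢ z →
    Σ (Fin n) λ w → E x w × E z w × ¬ E y w
  common-neighbour-avoiding {x = x} {y} {z} ψ not-colourable xy y≢z
    with every-colour-on-B x z ψ not-colourable (proj₁ ψ y)
  ... | w , xw , zw , ψw≡ψy = w , xw , zw , λ yw →
    proj₂ ψ y w (∈⊤-a-b (E⇒≢ xy ∘ sym) y≢z) (∈⊤-a-b (E⇒≢ xw ∘ sym) (E⇒≢ zw ∘ sym))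
      yw (sym ψw≡ψy)

module CriticalGraphs {n : ℕ} (G : Graph n) (k : ℕ) (χ : Chromatic G k)
                      (critical : Critical G) where
  open Colourings G

  not-colourable : ∀ {c} → c < k → ¬ Colourable G ⊤ c
  not-colourable c<k = proj₂ χ _ c<k

  -- A critical graph has no isolated vertex: a colouring of G - x would
  -- extend to G without a new colour.
  has-neighbour : ∀ x → Σ (Fin n) λ v → E x v
  has-neighbour x with Fin.any? (E? x)
  ... | yes found = found
  ... | no isolated with critical k χ x
  ...   | j , ((c , c-proper) , _) , j<k = ⊥-elim (not-colourable j<k (c , proper))
    where
    proper : ∀ u v → u ∈ ⊤ → v ∈ ⊤ → E u v → c u ≢ c v
    proper u v _ _ e with u ≟ x | v ≟ x
    ... | yes refl | _        = ⊥-elim (isolated (v , e))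
    ... | no _     | yes refl = ⊥-elim (isolated (u , E-sym e))
    ... | no u≢x   | no v≢x   =
      c-proper u v (x∈p∧x≢y⇒x∈p-y ∈⊤ u≢x) (x∈p∧x≢y⇒x∈p-y ∈⊤ v≢x) e

  -- A clique with at least k vertices contains every vertex: otherwise it
  -- survives in G - v, which is coloured with fewer than k colours.
  clique-spans : ∀ {m} (w : Fin m → Fin n) → (∀ a a' → a ≢ a' → E (w a) (w a')) →
                 k ≤ m → ∀ v → Σ (Fin m) λ a → w a ≡ v
  clique-spans w clique k≤m v with Fin.any? (λ a → w a ≟ v)
  ... | yes found = found
  ... | no missing with critical k χ v
  ...   | j , ((c , c-proper) , _) , j<k
    with Fin.pigeonhole (ℕ.<-≤-trans j<k k≤m) (c ∘ w)
  ...     | a , a' , a<a' , same-colour = ⊥-elim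
    (c-proper (w a) (w a') (x∈p∧x≢y⇒x∈p-y ∈⊤ (λ e → missing (a , e)))
              (x∈p∧x≢y⇒x∈p-y ∈⊤ (λ e → missing (a' , e)))
              (clique a a' (Fin.<⇒≢ a<a')) same-colour)

module DoubleCriticalGraphs {n : ℕ} (G : Graph n) (k : ℕ) (χ : Chromatic G k)
                            (double-critical : DoubleCritical G) where
  open Colourings G
  open CriticalGraphs G k χ (proj₁ double-critical)

  colouring-without-edge : ∀ {x y} → E x y →
    Σ ℕ λ j → Colourable G (⊤ - x - y) j × suc j < k
  colouring-without-edge {x} {y} xy with proj₂ double-critical k χ x y xy
  ... | j , (φ , _) , j≤k∸2 = j , φ , (begin
        2 + j        ≤⟨ ℕ.+-monoʳ-≤ 2 j≤k∸2 ⟩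
        2 + (k ∸ 2)  ≡⟨ ℕ.m+[n∸m]≡n (edge⇒2≤colours (proj₁ χ) xy) ⟩
        k            ∎)
    where open ℕ.≤-Reasoning

  record CommonNeighbours (x y : Fin n) : Set where
    field
      size      : ℕ
      large     : k ≤ 2 + size
      vertex    : Fin size → Fin n
      injective : ∀ {i i'} → vertex i ≡ vertex i' → i ≡ i'
      adj-x     : ∀ i → E x (vertex i)
      adj-y     : ∀ i → E y (vertex i)

  -- Each colour of a (k-2)-colouring of G - x - y appears in B(xy).
  common-neighbours : ∀ {x y} → E x y → CommonNeighbours x y
  common-neighbours {x} {y} xy with colouring-without-edge xy
  ... | j , φ , 1+j<k = record
    { size      = j
    ; large     = ℕ.≮⇒≥ (λ j+2<k → not-colourable j+2<k (add-two-vertices x y φ))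
    ; vertex    = proj₁ ∘ witness
    ; injective = λ {i} {i'} eq →
        trans (sym (colour-of i)) (trans (cong (proj₁ φ) eq) (colour-of i'))
    ; adj-x     = proj₁ ∘ proj₂ ∘ witness
    ; adj-y     = proj₁ ∘ proj₂ ∘ proj₂ ∘ witness
    }
    where
    witness : (i : Fin j) → Σ (Fin n) λ b → E x b × E y b × proj₁ φ b ≡ i
    witness = every-colour-on-B x y φ (not-colourable 1+j<k)
    colour-of : ∀ i → proj₁ φ (proj₁ (witness i)) ≡ i
    colour-of i = proj₂ (proj₂ (proj₂ (witness i)))

  B-lower-bound : ∀ {x y} → E x y → k ∸ 1 ≤ ∣ B G x y ∣ + 1
  B-lower-bound {x} {y} xy = begin
    k ∸ 1           ≤⟨ ℕ.∸-monoˡ-≤ 1 large ⟩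
    1 + size        ≤⟨ s≤s size≤∣B∣ ⟩
    1 + ∣ B G x y ∣ ≡⟨ ℕ.+-comm 1 ∣ B G x y ∣ ⟩
    ∣ B G x y ∣ + 1 ∎
    where
    open ℕ.≤-Reasoning
    open CommonNeighbours (common-neighbours xy)
    size≤∣B∣ : size ≤ ∣ B G x y ∣
    size≤∣B∣ = injection⇒≤∣S∣ size vertex injective (B G x y)
      (λ i → x∈p∩q⁺ (E⇒∈N (adj-x i) , E⇒∈N (adj-y i)))

  -- If N(x) is a clique then G is complete: for a neighbour y of x, the
  -- vertices x, y and the family in B(xy) form a clique of size ≥ k.
  clique-neighbourhood⇒complete : ∀ x → (∀ u v → E x u → E x v → u ≢ v → E u v) →
                                  ∀ u v → u ≢ v → E u v
  clique-neighbourhood⇒complete x N-clique with has-neighbour x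
  ... | y , xy = λ u v u≢v → adjacent (spans u) (spans v) u≢v
    where
    open CommonNeighbours (common-neighbours xy)
    w : Fin (2 + size) → Fin n
    w zero = x
    w (suc zero) = y
    w (suc (suc i)) = vertex i
    clique : ∀ a a' → a ≢ a' → E (w a) (w a')
    clique zero          zero           a≢a' = ⊥-elim (a≢a' refl)
    clique zero          (suc zero)     _    = xy
    clique zero          (suc (suc i))  _    = adj-x i
    clique (suc zero)    zero           _    = E-sym xy
    clique (suc zero)    (suc zero)     a≢a' = ⊥-elim (a≢a' refl)
    clique (suc zero)    (suc (suc i))  _    = adj-y i
    clique (suc (suc i)) zero           _    = E-sym (adj-x i)
    clique (suc (suc i)) (suc zero)     _    = E-sym (adj-y i)
    clique (suc (suc i)) (suc (suc i')) a≢a' =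
      N-clique _ _ (adj-x i) (adj-x i') (distinct a≢a')
      where
      distinct : suc (suc i) ≢ suc (suc i') → vertex i ≢ vertex i'
      distinct ne eq with injective eq
      ... | refl = ne refl
    spans : ∀ t → Σ (Fin (2 + size)) λ a → w a ≡ t
    spans = clique-spans w clique large
    adjacent : ∀ {u v} → Σ (Fin (2 + size)) (λ a → w a ≡ u) →
               Σ (Fin (2 + size)) (λ a → w a ≡ v) → u ≢ v → E u v
    adjacent (a , refl) (a' , refl) u≢v = clique a a' (u≢v ∘ cong w)

  non-adjacent-pair : ∀ {x u v} → E x u → E x v → u ≢ v → ¬ E u v →
    Σ (Subset n) λ I → I ⊆ N G x × Independent G I × ∣ I ∣ ≡ 2
  non-adjacent-pair {x} {u} {v} xu xv u≢v ¬uv = ⁅ u ⁆ ∪ ⁅ v ⁆ , I⊆N , independent , size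
    where
    element : ∀ {t} → t ∈ ⁅ u ⁆ ∪ ⁅ v ⁆ → t ≡ u ⊎ t ≡ v
    element t∈ with x∈p∪q⁻ ⁅ u ⁆ ⁅ v ⁆ t∈
    ... | inj₁ t∈u = inj₁ (x∈⁅y⁆⇒x≡y u t∈u)
    ... | inj₂ t∈v = inj₂ (x∈⁅y⁆⇒x≡y v t∈v)
    I⊆N : ⁅ u ⁆ ∪ ⁅ v ⁆ ⊆ N G x
    I⊆N t∈ with element t∈
    ... | inj₁ refl = E⇒∈N xu
    ... | inj₂ refl = E⇒∈N xv
    independent : Independent G (⁅ u ⁆ ∪ ⁅ v ⁆)
    independent a b a∈ b∈ e with element a∈ | element b∈
    ... | inj₁ refl | inj₁ refl = E-irr e
    ... | inj₁ refl | inj₂ refl = ¬uv e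
    ... | inj₂ refl | inj₁ refl = ¬uv (E-sym e)
    ... | inj₂ refl | inj₂ refl = E-irr e
    size : ∣ ⁅ u ⁆ ∪ ⁅ v ⁆ ∣ ≡ 2
    size = trans (∣p∪q∣≡∣p∣+∣q∣ ⁅ u ⁆ ⁅ v ⁆
                   (λ a b → u≢v (trans (sym (x∈⁅y⁆⇒x≡y u a)) (x∈⁅y⁆⇒x≡y v b))))
                 (cong₂ _+_ (∣⁅x⁆∣≡1 u) (∣⁅x⁆∣≡1 v))

  two≤independence-number : NonComplete G → ∀ x α → IndependenceNumber G (N G x) α → 2 ≤ α
  two≤independence-number (u₀ , v₀ , u₀≢v₀ , ¬u₀v₀) x α (_ , maximum) with 2 ℕ.≤? α
  ... | yes 2≤α = 2≤α
  ... | no 2≰α = ⊥-elim (¬u₀v₀ (clique-neighbourhood⇒complete x N-clique u₀ v₀ u₀≢v₀))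
    where
    N-clique : ∀ u v → E x u → E x v → u ≢ v → E u v
    N-clique u v xu xv u≢v with E? u v
    ... | yes uv = uv
    ... | no ¬uv with non-adjacent-pair xu xv u≢v ¬uv
    ...   | I , I⊆N , independent , ∣I∣≡2 =
      ⊥-elim (2≰α (subst (_≤ α) ∣I∣≡2 (maximum I I⊆N independent)))

  independent⊆N : ∀ {x y} (I : Subset n) → I ⊆ N[_] G x → Independent G I →
                  y ∈ I → E x y → I ⊆ N G x
  independent⊆N {x} {y} I I⊆N[x] independent y∈I xy {t} t∈I
    with x∈p∪q⁻ (N G x) ⁅ x ⁆ (I⊆N[x] t∈I)
  ... | inj₁ t∈N = t∈N
  ... | inj₂ t∈x = ⊥-elim (independent x y (subst (_∈ I) (x∈⁅y⁆⇒x≡y x t∈x) t∈I) y∈I xy)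

  -- Counting core: if I ⊆ N(x) is independent and contains y and z, and
  -- w ∈ N(x) is adjacent to z but not to y, then B(xy), {w} and I are disjoint
  -- subsets of N(x).
  disjoint-parts-of-N : ∀ {x y z w} (I : Subset n) → I ⊆ N G x → Independent G I →
    y ∈ I → z ∈ I → E x w → E z w → ¬ E y w → ∣ B G x y ∣ + 1 + ∣ I ∣ ≤ deg G x
  disjoint-parts-of-N {x} {y} {z} {w} I I⊆N independent y∈I z∈I xw zw ¬yw =
    subst (_≤ deg G x) size (p⊆q⇒∣p∣≤∣q∣ {p = (B G x y ∪ ⁅ w ⁆) ∪ I} ⊆N)
    where
    ∈B⇒E-y : ∀ {v} → v ∈ B G x y → E y v
    ∈B⇒E-y v∈B = ∈N⇒E (proj₂ (x∈p∩q⁻ (N G x) (N G y) v∈B))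
    B-w-disjoint : ∀ {v} → v ∈ B G x y → v ∈ ⁅ w ⁆ → ⊥
    B-w-disjoint v∈B v∈w with x∈⁅y⁆⇒x≡y w v∈w
    ... | refl = ¬yw (∈B⇒E-y v∈B)
    Bw-I-disjoint : ∀ {v} → v ∈ B G x y ∪ ⁅ w ⁆ → v ∈ I → ⊥
    Bw-I-disjoint {v} v∈ v∈I with x∈p∪q⁻ (B G x y) ⁅ w ⁆ v∈
    ... | inj₁ v∈B = independent y v y∈I v∈I (∈B⇒E-y v∈B)
    ... | inj₂ v∈w with x∈⁅y⁆⇒x≡y w v∈w
    ...   | refl = independent z v z∈I v∈I zw
    size : ∣ (B G x y ∪ ⁅ w ⁆) ∪ I ∣ ≡ ∣ B G x y ∣ + 1 + ∣ I ∣
    size = trans (∣p∪q∣≡∣p∣+∣q∣ _ I Bw-I-disjoint)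
             (cong (_+ ∣ I ∣) (trans (∣p∪q∣≡∣p∣+∣q∣ _ _ B-w-disjoint)
                                     (cong (∣ B G x y ∣ +_) (∣⁅x⁆∣≡1 w))))
    ⊆N : (B G x y ∪ ⁅ w ⁆) ∪ I ⊆ N G x
    ⊆N t∈ with x∈p∪q⁻ (B G x y ∪ ⁅ w ⁆) I t∈
    ... | inj₂ t∈I = I⊆N t∈I
    ... | inj₁ t∈Bw with x∈p∪q⁻ (B G x y) ⁅ w ⁆ t∈Bw
    ...   | inj₁ t∈B = proj₁ (x∈p∩q⁻ (N G x) (N G y) t∈B)
    ...   | inj₂ t∈w with x∈⁅y⁆⇒x≡y w t∈w
    ...     | refl = E⇒∈N xw

  -- deg(x) - α ≥ |B(xy)| + 1 when y lies in an independent set I ⊆ N[x] of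
  -- size α ≥ 2: for z ∈ I ∖ {y}, the edge xz supplies a neighbour
  -- w ∈ N(x) ∩ N(z) outside N(y).
  degree-bound : ∀ {x y α} → 2 ≤ α → E x y →
    (Σ (Subset n) λ I → I ⊆ N[_] G x × Independent G I × y ∈ I × ∣ I ∣ ≡ α) →
    ∣ B G x y ∣ + 1 ≤ deg G x ∸ α
  degree-bound {x} {y} 2≤∣I∣ xy (I , I⊆N[x] , independent , y∈I , refl)
    with another-element I y 2≤∣I∣
  ... | z , z∈I , z≢y
    with colouring-without-edge (∈N⇒E (independent⊆N I I⊆N[x] independent y∈I xy z∈I))
  ... | j , ψ , 1+j<k
    with common-neighbour-avoiding ψ (not-colourable 1+j<k) xy (z≢y ∘ sym)
  ... | w , xw , zw , ¬yw =
    ℕ.m+n≤o⇒m≤o∸n (∣ B G x y ∣ + 1)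
      (disjoint-parts-of-N I (independent⊆N I I⊆N[x] independent y∈I xy)
                           independent y∈I z∈I xw zw ¬yw)

proposition12 : (n : ℕ) (G : Graph n) (k : ℕ) → Chromatic G k → DoubleCritical G → NonComplete G →
    (x : Fin n) (α : ℕ) → IndependenceNumber G (N G x) α →
      (2 ≤ α)
      × ((y : Fin n) → y ∈ N G x →
          (Σ (Subset n) λ I → I ⊆ N[_] G x × Independent G I × y ∈ I × ∣ I ∣ ≡ α) →
          (∣ B G x y ∣ + 1 ≤ deg G x ∸ α) × (k ∸ 1 ≤ ∣ B G x y ∣ + 1))
proposition12 n G k χ double-critical non-complete x α α-is-independence-number =
  two≤α , λ y y∈N I → degree-bound two≤α (xy y∈N) I , B-lower-bound (xy y∈N)
  where
  open Colourings G using (∈N⇒E)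
  open DoubleCriticalGraphs G k χ double-critical
  two≤α : 2 ≤ α
  two≤α = two≤independence-number non-complete x α α-is-independence-number
  xy : ∀ {y} → y ∈ N G x → Edge G x y
  xy = ∈N⇒E
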